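{- Let $\mathcal{GO}=\langle t,\prec,\phi\rangle$ be a GOMT problem with $\phi$ satisfiable, and let $\langle \mathcal{I},\Delta,\tau\rangle$ be a saturated state occurring in a $\mathcal{GO}$-derivation. Then $\mathcal{I}$ is an optimal solution ($\mathcal{GO}$-solution) of $\mathcal{GO}$.
   Context: Fix a many-sorted first-order theory $\mathcal{T}$ (a signature $\Sigma$ together with a class of $\Sigma$-interpretations, the $\mathcal{T}$-interpretations) with equality, and an infinite set of sorted variables; all interpretations considered are $\mathcal{T}$-interpretations assigning a value to every variable, and $\models$ means $\models_{\mathcal{T}}$ (for formulas $\alpha,\beta$, $\alpha\models\beta$ means every $\mathcal{T}$-interpretation satisfying $\alpha$ satisfies $\beta$). A GOMT (Generalized Optimization Modulo Theories) problem is a triple $\mathcal{GO}=\langle t,\prec,\phi\rangle$ where $t$ is a $\Sigma$-term of some sort $\sigma$, $\prec$ is a strict partial order on the values of sort $\sigma$ that is definable in $\mathcal{T}$, and $\phi$ is a $\Sigma$-formula. An interpretation $\mathcal{I}$ is $\mathcal{GO}$-consistent if $\mathcal{I}\models\phi$; $\mathcal{I}$ $\mathcal{GO}$-dominates $\mathcal{I}'$, written $\mathcal{I}<_{\mathcal{GO}}\mathcal{I}'$, if both are $\mathcal{GO}$-consistent and $t^{\mathcal{I}}\prec t^{\mathcal{I}'}$; $\mathcal{I}$ is an optimal solution ($\mathcal{GO}$-solution) if it is $\mathcal{GO}$-consistent and no interpretation $\mathcal{GO}$-dominates it. $\textsc{Solve}$ is a function mapping a formula to an interpretation satisfying it if it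 is satisfiable, and to a distinguished value $\bot$ otherwise. $\textsc{Better}$ is a function mapping each $\mathcal{GO}$-consistent interpretation $\mathcal{I}$ to a formula $\textsc{Better}(\mathcal{I})$ such that for every $\mathcal{GO}$-consistent $\mathcal{I}'$: $\mathcal{I}'\models\textsc{Better}(\mathcal{I})$ iff $\mathcal{I}'<_{\mathcal{GO}}\mathcal{I}$. For a finite sequence $S=(s_1,\dots,s_n)$, $\textsc{Top}(S)=s_1$, $\textsc{Pop}(S)=(s_2,\dots,s_n)$, $\emptyset$ is the empty sequence and $\circ$ is concatenation. A state is a triple $\langle\mathcal{I},\Delta,\tau\rangle$ with $\mathcal{I}$ an interpretation, $\Delta$ a formula and $\tau$ a finite sequence of formulas. The initial state is $\langle\mathcal{I}_0,\Delta_0,\tau_0\rangle$ with $\mathcal{I}_0=\textsc{Solve}(\phi)$, $\Delta_0=\textsc{Better}(\mathcal{I}_0)$, $\tau_0=(\Delta_0)$. The derivation rules (components not mentioned are unchanged) are: F-Split: if $\tau\neq\emptyset$, $\psi=\textsc{Top}(\tau)$ and $\phi\models\psi\Leftrightarrow\bigvee_{j=1}^k\psi_j$ for some formulas $\psi_1,\dots,\psi_k$, $k\ge1$, then $\tau:=(\psi_1,\dots,\psi_k)\circ\textsc{Pop}(\tau)$. F-Sat: if $\tau\neq\emptyset$, $\psi=\textsc{Top}(\tau)$, $\textsc{Solve}(\phi\wedge\psi)=\mathcal{I}'\neq\bot$ and $\Delta'=\Delta\wedge\textsc{Better}(\mathcal{I}')$, then $\mathcal{I}:=\mathcal{I}'$,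 $\Delta:=\Delta'$, $\tau:=(\Delta')$. F-Close: if $\tau\neq\emptyset$, $\psi=\textsc{Top}(\tau)$ and $\textsc{Solve}(\phi\wedge\psi)=\bot$, then $\Delta:=\Delta\wedge\neg\psi$, $\tau:=\textsc{Pop}(\tau)$. A rule applies to a state if its premises hold and the resulting state is different. A state is saturated if no rule applies to it. A $\mathcal{GO}$-derivation is a (possibly infinite) sequence of states whose first element is the initial state and each subsequent state is obtained from the previous one by applying one of the rules. -}

module Defs where

open import Data.Product using (Σ; ∃; _×_; _,_)
open import Data.List using (List; []; _∷_; _++_)
open import Data.List.Relation.Unary.Any using (Any)
open import Data.Maybe using (Maybe; just; nothing)
open import Relation.Nullary using (¬_)
open import Relation.Binary.PropositionalEquality using (_≡_; _≢_)
open import Relation.Binary.Structures using (IsStrictPartialOrder)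
open import Function.Bundles using (_⇔_)

-- A theory T, presented semantically: its T-interpretations (which assign
-- values to all variables), its formulas, satisfaction, and the
-- connectives ∧ and ¬ used syntactically by the calculus.

record Theory : Set₁ where
  infix 4 _⊨_
  field
    Interp  : Set
    Formula : Set
    _⊨_     : Interp → Formula → Set
    _∧ᶠ_    : Formula → Formula → Formula
    ¬ᶠ_     : Formula → Formula
    ⊨-∧     : ∀ {I a b} → (I ⊨ (a ∧ᶠ b)) ⇔ (I ⊨ a × I ⊨ b)
    ⊨-¬     : ∀ {I a} → (I ⊨ (¬ᶠ a)) ⇔ (¬ (I ⊨ a))

-- A GOMT problem ⟨ t , ≺ , φ ⟩ over T.  The term t of sort σ is
-- represented by its evaluation map I ↦ t^I into the values Val of σ.

record GOMT (T : Theory) : Set₁ where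
  open Theory T
  field
    Val    : Set
    _≺_    : Val → Val → Set
    ≺-spo  : IsStrictPartialOrder _≡_ _≺_
    term   : Interp → Val
    φ      : Formula

module _ {T : Theory} (G : GOMT T) where
  open Theory T
  open GOMT G

  Consistent : Interp → Set
  Consistent I = I ⊨ φ

  Dominates : Interp → Interp → Set
  Dominates I I' = Consistent I × Consistent I' × (term I ≺ term I')

  Optimal : Interp → Set
  Optimal I = Consistent I × (∀ I' → ¬ Dominates I' I)

  -- Specification of Solve : formulas → interpretations ∪ {⊥}
  -- (nothing plays the role of ⊥).
  SolveSpec : (Formula → Maybe Interp) → Set
  SolveSpec Solve =
    (∀ ψ I → Solve ψ ≡ just I → I ⊨ ψ) ×
    (∀ ψ → Solve ψ ≡ nothing → ∀ I → ¬ (I ⊨ ψ))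

  BetterSpec : (Interp → Formula) → Set
  BetterSpec Better = ∀ I → Consistent I → ∀ I' → Consistent I' →
    (I' ⊨ Better I) ⇔ Dominates I' I

  record State : Set where
    constructor ⟨_,_,_⟩
    field
      I : Interp
      Δ : Formula
      τ : List Formula

  module Calculus (Solve : Formula → Maybe Interp)
                  (Better : Interp → Formula) where

    Initial : State → Set
    Initial s = Solve φ ≡ just (State.I s) ×
                State.Δ s ≡ Better (State.I s) ×
                State.τ s ≡ (Better (State.I s) ∷ [])

    -- premises of the three rules (without the "state changes" side
    -- condition)
    data Rule : State → State → Set where
      F-Split : ∀ {I Δ ψ τ} (ψs : List Formula) → ψs ≢ [] →
                (∀ J → J ⊨ φ → (J ⊨ ψ) ⇔ Any (J ⊨_) ψs) →
                Rule ⟨ I , Δ , ψ ∷ τ ⟩ ⟨ I , Δ , ψs ++ τ ⟩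
      F-Sat   : ∀ {I Δ ψ τ I'} → Solve (φ ∧ᶠ ψ) ≡ just I' →
                Rule ⟨ I , Δ , ψ ∷ τ ⟩
                     ⟨ I' , Δ ∧ᶠ Better I' , (Δ ∧ᶠ Better I') ∷ [] ⟩
      F-Close : ∀ {I Δ ψ τ} → Solve (φ ∧ᶠ ψ) ≡ nothing →
                Rule ⟨ I , Δ , ψ ∷ τ ⟩ ⟨ I , Δ ∧ᶠ (¬ᶠ ψ) , τ ⟩

    Step : State → State → Set
    Step s s' = Rule s s' × s ≢ s'

    Saturated : State → Set
    Saturated s = ∀ s' → ¬ Step s s'

    -- states occurring in a GO-derivation (prefixes of a possibly
    -- infinite derivation are finite derivations)
    data Occurs : State → Set where
      start : ∀ {s} → Initial s → Occurs s
      next  : ∀ {s s'} → Occurs s → Step s s' → Occurs s'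

-- Every reachable state satisfies an invariant: I is GO-consistent, every
-- interpretation dominating I satisfies Δ, and a consistent J satisfies
-- some formula of τ exactly when it dominates I.  Better establishes it
-- initially; F-Split preserves it because the split is equivalent modulo φ,
-- F-Sat because the new model dominates I (so its dominators satisfy Δ by
-- transitivity), and F-Close because the closed formula has no consistent
-- model.  In a saturated state τ is empty: otherwise F-Close would shorten
-- τ, or F-Sat would move to a model strictly better than I.  An empty τ
-- then says that nothing dominates I.
module Submission where

open import Defs
open import Data.Product using (∃; _×_; _,_; proj₁; proj₂)
open import Data.Sum using (inj₁; inj₂)
open import Data.Maybe using (Maybe; just; nothing)
open import Data.List using ([]; _∷_; _++_; length)
open import Data.List.Relation.Unary.Any using (Any; here; there)
open import Data.List.Relation.Unary.Any.Properties using (¬Any[]; ++⁺ˡ; ++⁺ʳ; ++⁻; singleton⁻)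
open import Data.Nat.Properties using (1+n≢n)
open import Data.Empty using (⊥-elim)
open import Function using (_∘_)
open import Function.Bundles using (_⇔_; mk⇔; Equivalence)
open import Function.Properties.Equivalence using () renaming (trans to ⇔-trans)
open import Relation.Nullary using (¬_)
open import Relation.Binary.PropositionalEquality using (_≡_; _≢_; refl; cong)
open import Relation.Binary.Structures using (IsStrictPartialOrder)

open Equivalence using (to; from)

Any-++-replace-head : ∀ {A : Set} {P : A → Set} {x} xs {ys} →
                      P x ⇔ Any P xs → Any P (xs ++ ys) ⇔ Any P (x ∷ ys)
Any-++-replace-head {P = P} {x} xs {ys} Px⇔xs = mk⇔ shrink expand
  where
  shrink : Any P (xs ++ ys) → Any P (x ∷ ys)
  shrink p with ++⁻ xs p
  ... | inj₁ q = here (from Px⇔xs q)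
  ... | inj₂ q = there q

  expand : Any P (x ∷ ys) → Any P (xs ++ ys)
  expand (here p)  = ++⁺ˡ (to Px⇔xs p)
  expand (there q) = ++⁺ʳ xs q

module Soundness {T : Theory} (G : GOMT T)
  (Solve : Theory.Formula T → Maybe (Theory.Interp T)) (solve-spec : SolveSpec G Solve)
  (Better : Theory.Interp T → Theory.Formula T) (better-spec : BetterSpec G Better) where

  open Theory T
  open GOMT G
  open Calculus G Solve Better
  open IsStrictPartialOrder ≺-spo using (irrefl) renaming (trans to ≺-trans)

  ⊨-∧⁺ : ∀ {I a b} → I ⊨ a → I ⊨ b → I ⊨ (a ∧ᶠ b)
  ⊨-∧⁺ p q = from ⊨-∧ (p , q)

  Dominates-trans : ∀ {I J K} → Dominates G I J → Dominates G J K → Dominates G I K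
  Dominates-trans (cI , _ , p) (_ , cK , q) = cI , cK , ≺-trans p q

  Dominates⇒≢ : ∀ {I J} → Dominates G J I → I ≢ J
  Dominates⇒≢ (_ , _ , J≺I) refl = irrefl refl J≺I

  solve-∧-model : ∀ {ψ I} → Solve (φ ∧ᶠ ψ) ≡ just I → Consistent G I × I ⊨ ψ
  solve-∧-model {ψ} {I} eq = to ⊨-∧ (proj₁ solve-spec (φ ∧ᶠ ψ) I eq)

  solve-∧-unsat : ∀ {ψ J} → Solve (φ ∧ᶠ ψ) ≡ nothing → Consistent G J → ¬ (J ⊨ ψ)
  solve-∧-unsat {ψ} {J} eq cJ Jψ = proj₂ solve-spec (φ ∧ᶠ ψ) eq J (⊨-∧⁺ cJ Jψ)

  record Invariant (s : State G) : Set where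
    open State s
    field
      consistent : Consistent G I
      Δ-complete : ∀ J → Dominates G J I → J ⊨ Δ
      τ-exact    : ∀ J → Consistent G J → Any (J ⊨_) τ ⇔ Dominates G J I

  open Invariant

  top-model-dominates : ∀ {I Δ ψ τ I'} → Invariant ⟨ I , Δ , ψ ∷ τ ⟩ →
                        Solve (φ ∧ᶠ ψ) ≡ just I' → Dominates G I' I
  top-model-dominates inv eq with solve-∧-model eq
  ... | cI' , I'ψ = to (τ-exact inv _ cI') (here I'ψ)

  initial-invariant : ∀ {s} → Initial s → Invariant s
  initial-invariant {⟨ I , _ , _ ⟩} (eq , refl , refl) = record
    { consistent = cI
    ; Δ-complete = λ J d → from (better-spec I cI J (proj₁ d)) d
    ; τ-exact    = λ J cJ → mk⇔ (to (better-spec I cI J cJ) ∘ singleton⁻)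
                                (here ∘ from (better-spec I cI J cJ))
    }
    where cI = proj₁ solve-spec φ I eq

  rule-preserves-invariant : ∀ {s s'} → Rule s s' → Invariant s → Invariant s'
  rule-preserves-invariant (F-Split ψs _ split) inv = record
    { consistent = consistent inv
    ; Δ-complete = Δ-complete inv
    ; τ-exact    = λ J cJ → ⇔-trans (Any-++-replace-head ψs (split J cJ)) (τ-exact inv J cJ)
    }
  rule-preserves-invariant (F-Sat {Δ = Δ} {I' = I'} eq) inv = record
    { consistent = cI'
    ; Δ-complete = new-Δ-complete
    ; τ-exact    = λ J cJ → mk⇔ (to (better-spec I' cI' J cJ) ∘ proj₂ ∘ to ⊨-∧ ∘ singleton⁻)
                                (here ∘ new-Δ-complete J)
    }
    where
    cI' = proj₁ (solve-∧-model eq)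

    new-Δ-complete : ∀ J → Dominates G J I' → J ⊨ (Δ ∧ᶠ Better I')
    new-Δ-complete J d =
      ⊨-∧⁺ (Δ-complete inv J (Dominates-trans d (top-model-dominates inv eq)))
           (from (better-spec I' cI' J (proj₁ d)) d)
  rule-preserves-invariant (F-Close {I = I} {τ = τ} eq) inv = record
    { consistent = consistent inv
    ; Δ-complete = λ J d → ⊨-∧⁺ (Δ-complete inv J d) (from ⊨-¬ (solve-∧-unsat eq (proj₁ d)))
    ; τ-exact    = λ J cJ → mk⇔ (to (τ-exact inv J cJ) ∘ there) (drop-top J cJ)
    }
    where
    drop-top : ∀ J → Consistent G J → Dominates G J I → Any (J ⊨_) τ
    drop-top J cJ d with from (τ-exact inv J cJ) d
    ... | here Jψ = ⊥-elim (solve-∧-unsat eq cJ Jψ)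
    ... | there q = q

  occurs⇒invariant : ∀ {s} → Occurs s → Invariant s
  occurs⇒invariant (start init)       = initial-invariant init
  occurs⇒invariant (next occ (r , _)) = rule-preserves-invariant r (occurs⇒invariant occ)

  saturated⇒τ≡[] : ∀ {s} → Invariant s → Saturated s → State.τ s ≡ []
  saturated⇒τ≡[] {⟨ _ , _ , [] ⟩}    _   _   = refl
  saturated⇒τ≡[] {⟨ _ , _ , ψ ∷ _ ⟩} inv sat with Solve (φ ∧ᶠ ψ) in eq
  ... | nothing = ⊥-elim (sat _ (F-Close eq , 1+n≢n ∘ cong (length ∘ State.τ)))
  ... | just _  = ⊥-elim (sat _ (F-Sat eq , Dominates⇒≢ (top-model-dominates inv eq) ∘ cong State.I))

  invariant-τ≡[]⇒optimal : ∀ {s} → Invariant s → State.τ s ≡ [] → Optimal G (State.I s)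
  invariant-τ≡[]⇒optimal {⟨ _ , _ , [] ⟩} inv refl =
    consistent inv , λ J d → ¬Any[] (from (τ-exact inv J (proj₁ d)) d)

theorem1 : (T : Theory) (G : GOMT T) →
    (Solve : Theory.Formula T → Maybe (Theory.Interp T)) → SolveSpec G Solve →
    (Better : Theory.Interp T → Theory.Formula T) → BetterSpec G Better →
    (∃ λ I → Theory._⊨_ T I (GOMT.φ G)) →
    (s : State G) → Calculus.Occurs G Solve Better s →
    Calculus.Saturated G Solve Better s →
    Optimal G (State.I s)
theorem1 T G Solve solve-spec Better better-spec _ s occ sat =
  invariant-τ≡[]⇒optimal inv (saturated⇒τ≡[] inv sat)
  where
  open Soundness G Solve solve-spec Better better-spec
  inv = occurs⇒invariant occ
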